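{- Let $M:\alpha\mapsto M_\alpha=(E,\mathcal{B}_\alpha)$ be a matroid flock with support matroid $N=(E,\mathcal{B})$. Then $\mathcal{B}=\bigcup_{\alpha\in\mathbb{Z}^E}\mathcal{B}_\alpha$.
   Context: A matroid flock of rank $d$ on $E$ assigns to each $\alpha\in\mathbb{Z}^E$ a matroid $M_\alpha$ on $E$ of rank $d$ with $M_\alpha/i=M_{\alpha+e_i}\setminus i$ and $M_\alpha=M_{\alpha+\mathbf{1}}$ for all $\alpha\in\mathbb{Z}^E$, $i\in E$. With $r_\alpha$ the rank function of $M_\alpha$ and $e_I=\sum_{i\in I}e_i$, let $g$ be the unique function $\mathbb{Z}^E\to\mathbb{Z}$ with $g(0)=0$ and $g(\alpha+e_I)=g(\alpha)+r_\alpha(I)$; let $f(\omega)=\sup_{\beta\in\mathbb{Z}^E}(\omega^T\beta-g(\beta))$ and $\nu(B)=f(e_B)$ for $B\in\binom{E}{d}$. The support matroid of the flock is the matroid on $E$ with bases $\{B\in\binom{E}{d}:\nu(B)<\infty\}$. -}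

module Defs where

open import Data.Nat as ℕ using (ℕ; _∸_)
open import Data.Integer as ℤ using (ℤ; +_)
open import Data.Bool using (Bool; true; false; if_then_else_)
open import Data.Vec using (Vec; zipWith; foldr; replicate)
open import Data.Fin using (Fin)
open import Data.Fin.Subset using (Subset; ⊤; ⁅_⁆; _∈_; _∉_; _⊆_; _∩_; _∪_; ∣_∣)
open import Data.Product using (∃; _×_)
open import Relation.Binary.PropositionalEquality using (_≡_)

record Matroid (n : ℕ) : Set where
  field
    rank        : Subset n → ℕ
    rank-bound  : ∀ X → rank X ℕ.≤ ∣ X ∣
    rank-mono   : ∀ X Y → X ⊆ Y → rank X ℕ.≤ rank Y
    rank-submod : ∀ X Y → rank (X ∪ Y) ℕ.+ rank (X ∩ Y) ℕ.≤ rank X ℕ.+ rank Y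
open Matroid public

IsBasis : ∀ {n} → Matroid n → Subset n → Set
IsBasis M B = (rank M B ≡ ∣ B ∣) × (∣ B ∣ ≡ rank M ⊤)

-- Rank functions of the minors M / i and M \ i (matroids on E - i),
-- evaluated on subsets X of E not containing i.
contractRank : ∀ {n} → Matroid n → Fin n → Subset n → ℕ
contractRank M i X = rank M (X ∪ ⁅ i ⁆) ∸ rank M ⁅ i ⁆

deleteRank : ∀ {n} → Matroid n → Fin n → Subset n → ℕ
deleteRank M i X = rank M X

_+e_ : ∀ {n} → Vec ℤ n → Subset n → Vec ℤ n
α +e I = zipWith (λ a b → if b then a ℤ.+ + 1 else a) α I

dotE : ∀ {n} → Subset n → Vec ℤ n → ℤ
dotE B β = foldr _ ℤ._+_ (+ 0) (zipWith (λ b x → if b then x else + 0) B β)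

0ᶻ : ∀ {n} → Vec ℤ n
0ᶻ = replicate _ (+ 0)

record Flock (n d : ℕ) : Set where
  field
    M        : Vec ℤ n → Matroid n
    rank-d   : ∀ α → rank (M α) ⊤ ≡ d
    flock    : ∀ α i X → i ∉ X →
               contractRank (M α) i X ≡ deleteRank (M (α +e ⁅ i ⁆)) i X
    periodic : ∀ α X → rank (M α) X ≡ rank (M (α +e ⊤)) X
open Flock public

IsG : ∀ {n d} → Flock n d → (Vec ℤ n → ℤ) → Set
IsG F g = (g 0ᶻ ≡ + 0) × (∀ α I → g (α +e I) ≡ g α ℤ.+ + rank (M F α) I)

-- ν(B) = f(e_B) = sup_β (e_B^T β − g β) < ∞
NuFinite : ∀ {n} → (Vec ℤ n → ℤ) → Subset n → Set
NuFinite g B = ∃ λ (c : ℤ) → ∀ β → dotE B β ℤ.- g β ℤ.≤ c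

SupportBasis : ∀ {n d} → Flock n d → (Vec ℤ n → ℤ) → Subset n → Set
SupportBasis {d = d} F g B = (∣ B ∣ ≡ d) × NuFinite g B

module Submission where

-- Fix B with |B| = d and consider the potential
--     ψ(γ) = e_Bᵀγ − g(γ),
-- so that ν(B) < ∞ means exactly that ψ is bounded above.  A step γ ↦ γ + e_I
-- changes ψ by |B ∩ I| − r_γ(I), and ψ is invariant under γ ↦ γ + 𝟏.
--
-- (⇒) If B is dependent in M_β then the step β ↦ β + e_B raises ψ by at
--     least one; a bounded ψ can only be raised finitely often, so climbing
--     from 0 eventually reaches some M_α with B independent, i.e. a basis.
-- (⇐) If B is a basis of M_α, then ψ(β) ≤ ψ(α) for every β: after adding a
--     multiple of 𝟏 we may assume α ≤ β, and we walk from α up to β along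
--     γ ↦ γ + e_J, where J is the set of coordinates still at maximal distance
--     from β.  These sets grow along the walk, and we maintain that
--     |B ∩ K| ≤ r_γ(K) for every K containing the current J; this makes every
--     step decrease ψ.  The invariant survives a step because r_γ(K) ≤
--     r_{γ+e_J}(K) for J ⊆ K, a consequence of the cocycle identity for g and
--     submodularity.

open import Defs
open import Data.Nat using (ℕ)
open import Data.Integer using (ℤ)
open import Data.Vec using (Vec)
open import Data.Fin.Subset using (Subset)
open import Data.Product using (∃)
open import Function.Bundles using (_⇔_)

open import Data.Nat as ℕ using (zero; suc)
import Data.Nat.Properties as ℕP
import Data.Nat.Tactic.RingSolver as ℕSolver
open import Data.Integer as ℤ using (+_; _-_; +≤+)
import Data.Integer.Properties as ℤP
import Data.Integer.Tactic.RingSolver as ℤSolver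
open import Algebra.Bundles using (AbelianGroup)
open import Algebra.Properties.Group (AbelianGroup.group ℤP.+-0-abelianGroup)
  using (∙-cancelˡ; ∙-cancelʳ)
open import Data.Vec using ([]; _∷_; map)
open import Data.Vec.Relation.Binary.Pointwise.Inductive as Pointwise
  using (Pointwise; []; _∷_)
open import Data.Fin.Subset
  using (inside; outside; ⊤; ⊥; _∩_; _∪_; _─_; ∣_∣; _⊆_)
open import Data.Fin.Subset.Properties
  using (drop-∷-⊆; ⊆-trans; ⊥⊆; ⊆⊤; p∩q⊆p; p∩q⊆q; ∩-idem; ∩-identityʳ)
open import Data.Vec.Base using (here; there)
open import Data.Product using (_,_; _×_; proj₂)
open import Data.Empty using (⊥-elim)
open import Relation.Binary.PropositionalEquality
  using (_≡_; _≢_; refl; sym; trans; cong; cong₂; module ≡-Reasoning)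
open import Relation.Nullary using (yes; no; does; ¬_)
open import Function.Bundles using (mk⇔)

i≤+∣i∣ : ∀ i → i ℤ.≤ + ℤ.∣ i ∣
i≤+∣i∣ (+ _)      = ℤP.≤-refl
i≤+∣i∣ ℤ.-[1+ _ ] = ℤ.-≤+

∣i-j∣≤n⇒i≤j+n : ∀ i j {n} → ℤ.∣ i - j ∣ ℕ.≤ n → i ℤ.≤ j ℤ.+ + n
∣i-j∣≤n⇒i≤j+n i j {n} h = begin
  i                   ≡⟨ j+[i-j]≡i i j ⟨
  j ℤ.+ (i - j)       ≤⟨ ℤP.+-monoʳ-≤ j (i≤+∣i∣ (i - j)) ⟩
  j ℤ.+ + ℤ.∣ i - j ∣ ≤⟨ ℤP.+-monoʳ-≤ j (+≤+ h) ⟩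
  j ℤ.+ + n           ∎
  where
  open ℤP.≤-Reasoning
  j+[i-j]≡i : ∀ i j → j ℤ.+ (i - j) ≡ i
  j+[i-j]≡i = ℤSolver.solve-∀

+-cancelʳ-≤ : ∀ k {i j} → i ℤ.+ k ℤ.≤ j ℤ.+ k → i ℤ.≤ j
+-cancelʳ-≤ k {i} {j} le = begin
  i                     ≡⟨ [i+k]-k≡i i k ⟨
  (i ℤ.+ k) ℤ.+ ℤ.- k   ≤⟨ ℤP.+-monoˡ-≤ (ℤ.- k) le ⟩
  (j ℤ.+ k) ℤ.+ ℤ.- k   ≡⟨ [i+k]-k≡i j k ⟩
  j                     ∎
  where
  open ℤP.≤-Reasoning
  [i+k]-k≡i : ∀ i k → (i ℤ.+ k) ℤ.+ ℤ.- k ≡ i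
  [i+k]-k≡i = ℤSolver.solve-∀

-- Adding t + 1 is adding t and then 1 (stated with an abstract t so that it
-- applies to i ℤ.+ + suc m, which is i ℤ.+ (+ 1 ℤ.+ + m) by computation).
i+[1+t]≡[i+t]+1 : ∀ i t → i ℤ.+ (+ 1 ℤ.+ t) ≡ (i ℤ.+ t) ℤ.+ + 1
i+[1+t]≡[i+t]+1 = ℤSolver.solve-∀

<+suc⇒≤ : ∀ i j m → j ℤ.< i ℤ.+ + suc m → j ℤ.≤ i ℤ.+ + m
<+suc⇒≤ i j m j< = +-cancelʳ-≤ (+ 1) (begin
  j ℤ.+ + 1             ≡⟨ ℤP.+-comm j (+ 1) ⟩
  + 1 ℤ.+ j             ≤⟨ ℤP.i<j⇒suc[i]≤j j< ⟩
  i ℤ.+ + suc m         ≡⟨ i+[1+t]≡[i+t]+1 i (+ m) ⟩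
  (i ℤ.+ + m) ℤ.+ + 1   ∎)
  where open ℤP.≤-Reasoning

-- Subsets.  Lemmas about J ⊆ K are proved coordinatewise; the only
-- coordinate pattern excluded by J ⊆ K is (inside, outside).

inside∷p⊈outside∷q : ∀ {k} {p q : Subset k} → ¬ (inside ∷ p ⊆ outside ∷ q)
inside∷p⊈outside∷q s with s here
... | ()

⊆⇒∪─≡ : ∀ {k} {X B : Subset k} → X ⊆ B → X ∪ (B ─ X) ≡ B
⊆⇒∪─≡ {X = []}          {[]}          _ = refl
⊆⇒∪─≡ {X = inside ∷ X}  {inside ∷ B}  s = cong (inside ∷_) (⊆⇒∪─≡ (drop-∷-⊆ s))
⊆⇒∪─≡ {X = inside ∷ X}  {outside ∷ B} s = ⊥-elim (inside∷p⊈outside∷q s)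
⊆⇒∪─≡ {X = outside ∷ X} {t ∷ B}       s = cong (t ∷_) (⊆⇒∪─≡ (drop-∷-⊆ s))

⊆⇒∣∣-split : ∀ {k} {X B : Subset k} → X ⊆ B → ∣ B ∣ ≡ ∣ X ∣ ℕ.+ ∣ B ─ X ∣
⊆⇒∣∣-split {X = []}          {[]}          _ = refl
⊆⇒∣∣-split {X = inside ∷ X}  {inside ∷ B}  s = cong suc (⊆⇒∣∣-split (drop-∷-⊆ s))
⊆⇒∣∣-split {X = inside ∷ X}  {outside ∷ B} s = ⊥-elim (inside∷p⊈outside∷q s)
⊆⇒∣∣-split {X = outside ∷ X} {inside ∷ B}  s =
  trans (cong suc (⊆⇒∣∣-split (drop-∷-⊆ s))) (sym (ℕP.+-suc ∣ X ∣ ∣ B ─ X ∣))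
⊆⇒∣∣-split {X = outside ∷ X} {outside ∷ B} s = ⊆⇒∣∣-split (drop-∷-⊆ s)

-- The two set identities behind submodularity applied to K and E ─ J.
⊆⇒∪⊤─≡⊤ : ∀ {k} {J K : Subset k} → J ⊆ K → K ∪ (⊤ ─ J) ≡ ⊤
⊆⇒∪⊤─≡⊤ {J = []}          {[]}          _ = refl
⊆⇒∪⊤─≡⊤ {J = inside ∷ J}  {inside ∷ K}  s = cong (inside ∷_) (⊆⇒∪⊤─≡⊤ (drop-∷-⊆ s))
⊆⇒∪⊤─≡⊤ {J = inside ∷ J}  {outside ∷ K} s = ⊥-elim (inside∷p⊈outside∷q s)
⊆⇒∪⊤─≡⊤ {J = outside ∷ J} {inside ∷ K}  s = cong (inside ∷_) (⊆⇒∪⊤─≡⊤ (drop-∷-⊆ s))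
⊆⇒∪⊤─≡⊤ {J = outside ∷ J} {outside ∷ K} s = cong (inside ∷_) (⊆⇒∪⊤─≡⊤ (drop-∷-⊆ s))

∩⊤─≡─ : ∀ {k} (K J : Subset k) → K ∩ (⊤ ─ J) ≡ K ─ J
∩⊤─≡─ []            []            = refl
∩⊤─≡─ (inside ∷ K)  (inside ∷ J)  = cong (outside ∷_) (∩⊤─≡─ K J)
∩⊤─≡─ (inside ∷ K)  (outside ∷ J) = cong (inside ∷_) (∩⊤─≡─ K J)
∩⊤─≡─ (outside ∷ K) (inside ∷ J)  = cong (outside ∷_) (∩⊤─≡─ K J)
∩⊤─≡─ (outside ∷ K) (outside ∷ J) = cong (outside ∷_) (∩⊤─≡─ K J)

+e-split : ∀ {k} (γ : Vec ℤ k) {J K : Subset k} → J ⊆ K → (γ +e J) +e (K ─ J) ≡ γ +e K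
+e-split []      {[]}          {[]}          _ = refl
+e-split (y ∷ γ) {inside ∷ J}  {inside ∷ K}  s = cong (_ ∷_) (+e-split γ (drop-∷-⊆ s))
+e-split (y ∷ γ) {inside ∷ J}  {outside ∷ K} s = ⊥-elim (inside∷p⊈outside∷q s)
+e-split (y ∷ γ) {outside ∷ J} {t ∷ K}       s = cong (_ ∷_) (+e-split γ (drop-∷-⊆ s))

dotE-+e : ∀ {k} (B I : Subset k) (γ : Vec ℤ k) →
          dotE B (γ +e I) ≡ dotE B γ ℤ.+ + ∣ B ∩ I ∣
dotE-+e []            []            []      = refl
dotE-+e (inside ∷ B)  (inside ∷ I)  (y ∷ γ) =
  trans (cong (λ t → (y ℤ.+ + 1) ℤ.+ t) (dotE-+e B I γ)) (regroup y (dotE B γ) (+ ∣ B ∩ I ∣))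
  where
  regroup : ∀ y D c → (y ℤ.+ + 1) ℤ.+ (D ℤ.+ c) ≡ (y ℤ.+ D) ℤ.+ (+ 1 ℤ.+ c)
  regroup = ℤSolver.solve-∀
dotE-+e (inside ∷ B)  (outside ∷ I) (y ∷ γ) =
  trans (cong (λ t → y ℤ.+ t) (dotE-+e B I γ)) (sym (ℤP.+-assoc y (dotE B γ) (+ ∣ B ∩ I ∣)))
dotE-+e (outside ∷ B) (i ∷ I)       (y ∷ γ) =
  trans (cong (λ t → + 0 ℤ.+ t) (dotE-+e B I γ)) (sym (ℤP.+-assoc (+ 0) (dotE B γ) (+ ∣ B ∩ I ∣)))

raise : ∀ {k} → ℕ → Vec ℤ k → Vec ℤ k
raise t = map (λ b → b ℤ.+ + t)

raise-suc : ∀ {k} t (β : Vec ℤ k) → raise (suc t) β ≡ raise t β +e ⊤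
raise-suc t []      = refl
raise-suc t (b ∷ β) = cong₂ _∷_ (i+[1+t]≡[i+t]+1 b (+ t)) (raise-suc t β)

-- If γ ≤ β ≤ γ + m coordinatewise,
-- raising γ on its threshold set {i : γᵢ + m ≤ βᵢ} leaves a gap of at most
-- m − 1, and the threshold sets grow along the path.

threshold : ∀ {k} → ℕ → Vec ℤ k → Vec ℤ k → Subset k
threshold m []      []      = []
threshold m (b ∷ β) (y ∷ γ) = does (y ℤ.+ + m ℤP.≤? b) ∷ threshold m β γ

Within : ∀ {k} → ℕ → Vec ℤ k → Vec ℤ k → Set
Within m = Pointwise (λ b y → y ℤ.≤ b × b ℤ.≤ y ℤ.+ + m)

within-zero : ∀ {k} {β γ : Vec ℤ k} → Within 0 β γ → β ≡ γ
within-zero []                     = refl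
within-zero ((y≤b , b≤y+0) ∷ w) =
  cong₂ _∷_ (ℤP.≤-antisym (ℤP.≤-trans b≤y+0 (ℤP.≤-reflexive (ℤP.+-identityʳ _))) y≤b)
            (within-zero w)

within-step : ∀ {k} m (β γ : Vec ℤ k) →
              Within (suc m) β γ → Within m β (γ +e threshold (suc m) β γ)
within-step m []      []      []                 = []
within-step m (b ∷ β) (y ∷ γ) ((y≤b , b≤) ∷ w) with y ℤ.+ + suc m ℤP.≤? b
... | yes far = (y+1≤b , ℤP.≤-trans b≤ (ℤP.≤-reflexive (sym (ℤP.+-assoc y (+ 1) (+ m)))))
              ∷ within-step m β γ w
  where
  y+1≤b : y ℤ.+ + 1 ℤ.≤ b
  y+1≤b = ℤP.≤-trans (ℤP.+-monoʳ-≤ y (+≤+ (ℕ.s≤s ℕ.z≤n))) far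
... | no near = (y≤b , <+suc⇒≤ y b m (ℤP.≰⇒> near)) ∷ within-step m β γ w

threshold-step : ∀ {k} m (β γ : Vec ℤ k) →
                 threshold (suc m) β γ ⊆ threshold m β (γ +e threshold (suc m) β γ)
threshold-step m (b ∷ β) (y ∷ γ) x∈ with y ℤ.+ + suc m ℤP.≤? b
threshold-step m (b ∷ β) (y ∷ γ) (there x∈) | no _  = there (threshold-step m β γ x∈)
threshold-step m (b ∷ β) (y ∷ γ) (there x∈) | yes _ = there (threshold-step m β γ x∈)
threshold-step m (b ∷ β) (y ∷ γ) here       | yes far
  with (y ℤ.+ + 1) ℤ.+ + m ℤP.≤? b
... | yes _   = here
... | no near = ⊥-elim (near (ℤP.≤-trans (ℤP.≤-reflexive (ℤP.+-assoc y (+ 1) (+ m))) far))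

uniform-distance : ∀ {k} (β α : Vec ℤ k) →
                   ∃ λ N → Pointwise (λ b a → ℤ.∣ b - a ∣ ℕ.≤ N) β α
uniform-distance []      []      = 0 , []
uniform-distance (b ∷ β) (a ∷ α) with uniform-distance β α
... | N , close =
  ℤ.∣ b - a ∣ ℕ.⊔ N ,
  ℕP.m≤m⊔n _ N ∷ Pointwise.map (λ d≤N → ℕP.≤-trans d≤N (ℕP.m≤n⊔m _ N)) close

raise-within : ∀ {k} N {β α : Vec ℤ k} →
               Pointwise (λ b a → ℤ.∣ b - a ∣ ℕ.≤ N) β α → Within (N ℕ.+ N) (raise N β) α
raise-within N []                         = []
raise-within N (_∷_ {x = b} {y = a} d≤N close) =
  (∣i-j∣≤n⇒i≤j+n a b (ℕP.≤-trans (ℕP.≤-reflexive (ℤP.∣i-j∣≡∣j-i∣ a b)) d≤N) ,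
   ℤP.≤-trans (ℤP.+-monoˡ-≤ (+ N) (∣i-j∣≤n⇒i≤j+n b a d≤N))
              (ℤP.≤-reflexive (ℤP.+-assoc a (+ N) (+ N))))
  ∷ raise-within N close

-- In any matroid, subsets of an independent set are independent
-- (submodularity for X and B ─ X).

independent-subset : ∀ {k} (N : Matroid k) {B X : Subset k} →
                     rank N B ≡ ∣ B ∣ → X ⊆ B → ∣ X ∣ ℕ.≤ rank N X
independent-subset N {B} {X} rB X⊆B = ℕP.+-cancelʳ-≤ ∣ Y ∣ ∣ X ∣ (rank N X) (begin
  ∣ X ∣ ℕ.+ ∣ Y ∣                     ≡⟨ ⊆⇒∣∣-split X⊆B ⟨
  ∣ B ∣                               ≡⟨ rB ⟨
  rank N B                            ≤⟨ ℕP.m≤m+n _ _ ⟩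
  rank N B ℕ.+ rank N (X ∩ Y)         ≡⟨ cong (λ Z → rank N Z ℕ.+ rank N (X ∩ Y)) (⊆⇒∪─≡ X⊆B) ⟨
  rank N (X ∪ Y) ℕ.+ rank N (X ∩ Y)   ≤⟨ rank-submod N X Y ⟩
  rank N X ℕ.+ rank N Y               ≤⟨ ℕP.+-monoʳ-≤ (rank N X) (rank-bound N Y) ⟩
  rank N X ℕ.+ ∣ Y ∣                  ∎)
  where
  open ℕP.≤-Reasoning
  Y = B ─ X

module _ {n d : ℕ} (F : Flock n d) (g : Vec ℤ n → ℤ) (isG : IsG F g) where

  r : Vec ℤ n → Subset n → ℕ
  r γ = rank (M F γ)

  g-step : ∀ γ I → g (γ +e I) ≡ g γ ℤ.+ + r γ I
  g-step = proj₂ isG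

  -- Computing g(γ + e_K) through γ + e_J gives r_{γ+e_J}(K ─ J) + r_γ(J) = r_γ(K).
  rank-cocycle : ∀ γ {J K} → J ⊆ K → r (γ +e J) (K ─ J) ℕ.+ r γ J ≡ r γ K
  rank-cocycle γ {J} {K} J⊆K = ℤP.+-injective (∙-cancelˡ (g γ) _ _ (begin
    g γ ℤ.+ (+ a ℤ.+ + j)        ≡⟨ swap (g γ) (+ a) (+ j) ⟩
    (g γ ℤ.+ + j) ℤ.+ + a        ≡⟨ cong (λ t → t ℤ.+ + a) (g-step γ J) ⟨
    g (γ +e J) ℤ.+ + a           ≡⟨ g-step (γ +e J) (K ─ J) ⟨
    g ((γ +e J) +e (K ─ J))      ≡⟨ cong g (+e-split γ J⊆K) ⟩
    g (γ +e K)                   ≡⟨ g-step γ K ⟩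
    g γ ℤ.+ + r γ K              ∎))
    where
    open ≡-Reasoning
    a = r (γ +e J) (K ─ J)
    j = r γ J
    swap : ∀ x a j → x ℤ.+ (a ℤ.+ j) ≡ (x ℤ.+ j) ℤ.+ a
    swap = ℤSolver.solve-∀

  rank-raise : ∀ γ {J K} → J ⊆ K → r γ K ℕ.≤ r (γ +e J) K
  rank-raise γ {J} {K} J⊆K = ℕP.+-cancelʳ-≤ c (r γ K) (r′ K) (begin
    r γ K ℕ.+ c                       ≡⟨ cong (ℕ._+ c) (rank-cocycle γ J⊆K) ⟨
    (a ℕ.+ j) ℕ.+ c                   ≡⟨ swap a j c ⟩
    (c ℕ.+ j) ℕ.+ a                   ≡⟨ cong (ℕ._+ a) cocycle-⊤ ⟩
    d ℕ.+ a                           ≡⟨ cong₂ ℕ._+_ full (cong r′ (∩⊤─≡─ K J)) ⟨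
    r′ (K ∪ (⊤ ─ J)) ℕ.+ r′ (K ∩ (⊤ ─ J)) ≤⟨ rank-submod (M F (γ +e J)) K (⊤ ─ J) ⟩
    r′ K ℕ.+ c                        ∎)
    where
    open ℕP.≤-Reasoning
    r′ = r (γ +e J)
    a = r′ (K ─ J)
    c = r′ (⊤ ─ J)
    j = r γ J
    cocycle-⊤ : c ℕ.+ j ≡ d
    cocycle-⊤ = trans (rank-cocycle γ ⊆⊤) (rank-d F γ)
    full : r′ (K ∪ (⊤ ─ J)) ≡ d
    full = trans (cong r′ (⊆⇒∪⊤─≡⊤ J⊆K)) (rank-d F (γ +e J))
    swap : ∀ a j c → (a ℕ.+ j) ℕ.+ c ≡ (c ℕ.+ j) ℕ.+ a
    swap = ℕSolver.solve-∀

  module _ (B : Subset n) where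

    ψ : Vec ℤ n → ℤ
    ψ γ = dotE B γ - g γ

    ψ-step : ∀ γ I → ψ (γ +e I) ℤ.+ + r γ I ≡ ψ γ ℤ.+ + ∣ B ∩ I ∣
    ψ-step γ I = begin
      (dotE B (γ +e I) - g (γ +e I)) ℤ.+ + r γ I
        ≡⟨ cong₂ (λ D G → (D - G) ℤ.+ + r γ I) (dotE-+e B I γ) (g-step γ I) ⟩
      ((dotE B γ ℤ.+ + ∣ B ∩ I ∣) - (g γ ℤ.+ + r γ I)) ℤ.+ + r γ I
        ≡⟨ cancel (dotE B γ) (+ ∣ B ∩ I ∣) (g γ) (+ r γ I) ⟩
      ψ γ ℤ.+ + ∣ B ∩ I ∣ ∎
      where
      open ≡-Reasoning
      cancel : ∀ D c x y → ((D ℤ.+ c) - (x ℤ.+ y)) ℤ.+ y ≡ (D - x) ℤ.+ c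
      cancel = ℤSolver.solve-∀

    -- For |B| = d the increment along 𝟏 is |B| − r_γ(E) = 0.
    ψ-periodic : ∣ B ∣ ≡ d → ∀ γ → ψ (γ +e ⊤) ≡ ψ γ
    ψ-periodic ∣B∣≡d γ = ∙-cancelʳ (+ r γ ⊤) _ _ (begin
      ψ (γ +e ⊤) ℤ.+ + r γ ⊤    ≡⟨ ψ-step γ ⊤ ⟩
      ψ γ ℤ.+ + ∣ B ∩ ⊤ ∣       ≡⟨ cong (λ m → ψ γ ℤ.+ + m) B∩⊤ ⟩
      ψ γ ℤ.+ + r γ ⊤           ∎)
      where
      open ≡-Reasoning
      B∩⊤ : ∣ B ∩ ⊤ ∣ ≡ r γ ⊤
      B∩⊤ = trans (cong ∣_∣ (∩-identityʳ B))
                  (trans ∣B∣≡d (sym (rank-d F γ)))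

    Dominates : Vec ℤ n → Subset n → Set
    Dominates γ J = ∀ K → J ⊆ K → ∣ B ∩ K ∣ ℕ.≤ r γ K

    independent⇒dominates : ∀ {α} → r α B ≡ ∣ B ∣ → Dominates α ⊥
    independent⇒dominates {α} rB K _ =
      ℕP.≤-trans (independent-subset (M F α) rB (p∩q⊆p B K)) (rank-mono (M F α) (B ∩ K) K (p∩q⊆q B K))

    descend-ψ : ∀ {γ J J′} → Dominates γ J → J ⊆ J′ → ψ (γ +e J′) ℤ.≤ ψ γ
    descend-ψ {γ} {J} {J′} dom J⊆J′ = +-cancelʳ-≤ (+ r γ J′) (begin
      ψ (γ +e J′) ℤ.+ + r γ J′  ≡⟨ ψ-step γ J′ ⟩
      ψ γ ℤ.+ + ∣ B ∩ J′ ∣      ≤⟨ ℤP.+-monoʳ-≤ (ψ γ) (+≤+ (dom J′ J⊆J′)) ⟩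
      ψ γ ℤ.+ + r γ J′          ∎)
      where open ℤP.≤-Reasoning

    descend-dominates : ∀ {γ J J′} → Dominates γ J → J ⊆ J′ → Dominates (γ +e J′) J′
    descend-dominates {γ} dom J⊆J′ K J′⊆K =
      ℕP.≤-trans (dom K (⊆-trans J⊆J′ J′⊆K)) (rank-raise γ J′⊆K)

    walk : ∀ m {β γ J} → Within m β γ → J ⊆ threshold m β γ → Dominates γ J → ψ β ℤ.≤ ψ γ
    walk zero    w _ _ = ℤP.≤-reflexive (cong ψ (within-zero w))
    walk (suc m) {β} {γ} w J⊆T dom =
      ℤP.≤-trans (walk m (within-step m β γ w) (threshold-step m β γ) (descend-dominates dom J⊆T))
                 (descend-ψ dom J⊆T)

    ψ-raise : ∣ B ∣ ≡ d → ∀ t β → ψ (raise t β) ≡ ψ β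
    ψ-raise ∣B∣≡d zero    β = cong ψ (map-+0 β)
      where
      map-+0 : ∀ {k} (β : Vec ℤ k) → raise 0 β ≡ β
      map-+0 []      = refl
      map-+0 (b ∷ β) = cong₂ _∷_ (ℤP.+-identityʳ b) (map-+0 β)
    ψ-raise ∣B∣≡d (suc t) β =
      trans (cong ψ (raise-suc t β)) (trans (ψ-periodic ∣B∣≡d (raise t β)) (ψ-raise ∣B∣≡d t β))

    basis⇒ψ-max : ∀ {α} → IsBasis (M F α) B → ∀ β → ψ β ℤ.≤ ψ α
    basis⇒ψ-max {α} (rB , ∣B∣≡r⊤) β with uniform-distance β α
    ... | N , close = begin
      ψ β            ≡⟨ ψ-raise ∣B∣≡d N β ⟨
      ψ (raise N β)  ≤⟨ walk (N ℕ.+ N) (raise-within N close) ⊥⊆ (independent⇒dominates rB) ⟩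
      ψ α            ∎
      where
      open ℤP.≤-Reasoning
      ∣B∣≡d = trans ∣B∣≡r⊤ (rank-d F α)

    ψ-climb : ∀ β → r β B ≢ ∣ B ∣ → ψ β ℤ.+ + 1 ℤ.≤ ψ (β +e B)
    ψ-climb β dependent = +-cancelʳ-≤ (+ r β B) (begin
      (ψ β ℤ.+ + 1) ℤ.+ + r β B   ≡⟨ ℤP.+-assoc (ψ β) (+ 1) (+ r β B) ⟩
      ψ β ℤ.+ + suc (r β B)       ≤⟨ ℤP.+-monoʳ-≤ (ψ β) (+≤+ r<∣B∣) ⟩
      ψ β ℤ.+ + ∣ B ∣             ≡⟨ cong (λ X → ψ β ℤ.+ + ∣ X ∣) (∩-idem B) ⟨
      ψ β ℤ.+ + ∣ B ∩ B ∣         ≡⟨ ψ-step β B ⟨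
      ψ (β +e B) ℤ.+ + r β B      ∎)
      where
      open ℤP.≤-Reasoning
      r<∣B∣ = ℕP.≤∧≢⇒< (rank-bound (M F β) B) dependent

    -- (⇒) If ψ ≤ c < ψ(β) + f, then B is independent in some M_α: climbing
    -- from β, each dependent step gains at least one, which can happen fewer
    -- than f times.
    bounded⇒independent : ∀ c → (∀ β → ψ β ℤ.≤ c) →
                          ∀ f β → c ℤ.< ψ β ℤ.+ + f → ∃ λ α → r α B ≡ ∣ B ∣
    bounded⇒independent c ψ≤c zero β c< =
      ⊥-elim (ℤP.≤⇒≯ (ψ≤c β) (ℤP.<-≤-trans c< (ℤP.≤-reflexive (ℤP.+-identityʳ (ψ β)))))
    bounded⇒independent c ψ≤c (suc f) β c< with r β B ℕP.≟ ∣ B ∣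
    ... | yes independent = β , independent
    ... | no dependent = bounded⇒independent c ψ≤c f (β +e B) (begin-strict
      c                          <⟨ c< ⟩
      ψ β ℤ.+ + suc f            ≡⟨ ℤP.+-assoc (ψ β) (+ 1) (+ f) ⟨
      (ψ β ℤ.+ + 1) ℤ.+ + f      ≤⟨ ℤP.+-monoˡ-≤ (+ f) (ψ-climb β dependent) ⟩
      ψ (β +e B) ℤ.+ + f         ∎)
      where open ℤP.≤-Reasoning

    -- Start the climb at 0, where c < ψ(0) + (|c − ψ(0)| + 1).
    bounded⇒basis : ∣ B ∣ ≡ d → NuFinite g B → ∃ λ α → IsBasis (M F α) B
    bounded⇒basis ∣B∣≡d (c , ψ≤c)
      with bounded⇒independent c ψ≤c (suc N) 0ᶻ c<ψ0+1+N
      where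
      N = ℤ.∣ c - ψ 0ᶻ ∣
      c<ψ0+1+N : c ℤ.< ψ 0ᶻ ℤ.+ + suc N
      c<ψ0+1+N = ℤP.≤-<-trans (∣i-j∣≤n⇒i≤j+n c (ψ 0ᶻ) ℕP.≤-refl)
                              (ℤP.+-monoʳ-< (ψ 0ᶻ) (ℤ.+<+ (ℕP.n<1+n N)))
    ... | α , rB = α , rB , trans ∣B∣≡d (sym (rank-d F α))

lemma3p12 : ∀ {n d} (F : Flock n d) (g : Vec ℤ n → ℤ) → IsG F g →
    ∀ (B : Subset n) → SupportBasis F g B ⇔ (∃ λ (α : Vec ℤ n) → IsBasis (M F α) B)
lemma3p12 F g isG B = mk⇔
  (λ { (∣B∣≡d , finite) → bounded⇒basis F g isG B ∣B∣≡d finite })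
  (λ { (α , basis@(_ , ∣B∣≡r⊤)) → trans ∣B∣≡r⊤ (rank-d F α) ,
                     ψ F g isG B α , basis⇒ψ-max F g isG B basis })
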